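{- Let $X$ be a set of $n$ symbols, let $k\ge1$, and let $R$ be a $k$-Carthaginian rectangle on $X$. Then $R$ arises from a sharply $k$-transitive group action if and only if $R$ satisfies the $k$-rectangle condition.
   Context: For integers $n\ge k$, $n^{\underline{k}}=n(n-1)\cdots(n-k+1)$, and $X^{(k)}$ is the set of ordered $k$-tuples of distinct elements of $X$. A $k$-Carthaginian rectangle on $X$ is an $n^{\underline{k}}\times n$ matrix each of whose rows is a permutation (ordering) of $X$, such that for every choice of $k$ distinct columns, the $k$-tuples read off in those columns (over all rows) contain each element of $X^{(k)}$ exactly once. $R$ arises from a sharply $k$-transitive group action if there is a group $G$ acting sharply $k$-transitively on $X$ (i.e. for all $\mathbf{u},\mathbf{v}\in X^{(k)}$ there is exactly one $g\in G$ with $g\mathbf{u}=\mathbf{v}$, acting coordinatewise) and an enumeration $(x_1,\ldots,x_n)$ of $X$ such that the rows of $R$ are exactly the sequences $(gx_1,\ldots,gx_n)$, $g\in G$, each occurring once (the order of rows being irrelevant). A $2\times(k+1)$ submatrix of $R$ is obtained by choosing two rows and $k+1$ distinct columns of $R$ (in some order). $R$ satisfies the $k$-rectangle condition if whenever two $2\times(k+1)$ submatrices $A$ and $B$ of $R$ agree in $2k+1$ of their corresponding entries, they also agree in the remaining entry. -}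

module Defs where

open import Level using (0ℓ)
open import Data.Nat using (ℕ)
open import Data.Nat.Combinatorics using (_P_)
open import Data.Fin using (Fin)
open import Data.Product using (Σ; _×_; ∃; ∃!)
open import Data.Sum using (_⊎_)
open import Function.Definitions using (Injective; Bijective)
open import Relation.Binary.PropositionalEquality using (_≡_; _≢_)
open import Algebra.Bundles using (Group)

-- X^(k): ordered k-tuples of distinct elements of Fin n,
-- i.e. injective maps Fin k → Fin n.
Distinct : ∀ {k n} → (Fin k → Fin n) → Set
Distinct u = Injective _≡_ _≡_ u

-- A matrix with (n P k) = n^{falling k} rows and n columns, entries in X = Fin n.
Matrix : ℕ → ℕ → Set
Matrix n k = Fin (n P k) → Fin n → Fin n

IsCarthaginian : (n k : ℕ) → Matrix n k → Set
IsCarthaginian n k R =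
  (∀ i → Bijective _≡_ _≡_ (R i))
  ×
  (∀ (c : Fin k → Fin n) → Distinct c →
   ∀ (u : Fin k → Fin n) → Distinct u →
   ∃! _≡_ λ (i : Fin (n P k)) → ∀ j → R i (c j) ≡ u j)

record IsAction {c ℓ : _} (G : Group c ℓ) (n : ℕ)
                (act : Group.Carrier G → Fin n → Fin n) : Set (c Level.⊔ ℓ) where
  open Group G
  field
    act-cong  : ∀ {g h} → g ≈ h → ∀ x → act g x ≡ act h x
    act-ε     : ∀ x → act ε x ≡ x
    act-∙     : ∀ g h x → act (g ∙ h) x ≡ act g (act h x)

IsSharplyKTransitive : {c ℓ : _} (G : Group c ℓ) (n k : ℕ)
                       (act : Group.Carrier G → Fin n → Fin n) → Set (c Level.⊔ ℓ)
IsSharplyKTransitive G n k act =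
  ∀ (u v : Fin k → Fin n) → Distinct u → Distinct v →
  ∃! (Group._≈_ G) λ g → ∀ j → act g (u j) ≡ v j

ArisesFromSharplyKTransitive : (n k : ℕ) → Matrix n k → Set₁
ArisesFromSharplyKTransitive n k R =
  Σ (Group 0ℓ 0ℓ) λ G →
  Σ (Group.Carrier G → Fin n → Fin n) λ act →
  IsAction G n act ×
  IsSharplyKTransitive G n k act ×
  Σ (Fin n → Fin n) λ x →
    Bijective _≡_ _≡_ x ×
    (∀ i → ∃ λ g → ∀ col → R i col ≡ act g (x col)) ×
    (∀ g → ∃! _≡_ λ i → ∀ col → R i col ≡ act g (x col))

-- A 2×(k+1) submatrix is given by an ordered pair of
-- distinct rows ρ : Fin 2 → rows (injective) and an ordered choice of k+1
-- distinct columns c : Fin (k+1) → Fin n (injective); its (p,q) entry is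
-- R (ρ p) (c q).
RectangleCondition : (n k : ℕ) → Matrix n k → Set
RectangleCondition n k R =
  ∀ (ρ ρ′ : Fin 2 → Fin (n P k)) → Distinct ρ → Distinct ρ′ →
  ∀ (c c′ : Fin (ℕ.suc k) → Fin n) → Distinct c → Distinct c′ →
  ∀ (p : Fin 2) (q : Fin (ℕ.suc k)) →
  (∀ p′ q′ → (p′ ≢ p ⊎ q′ ≢ q) → R (ρ p′) (c q′) ≡ R (ρ′ p′) (c′ q′)) →
  R (ρ p) (c q) ≡ R (ρ′ p) (c′ q)

-- Forward: if the rows of R are the sequences g x, an entry of row g x in
-- column c equals an entry of row h x in column c′ iff h⁻¹ g maps x c to x c′.
-- In two 2×(k+1) submatrices agreeing off one entry, both row pairs agree in
-- k common column positions, so by sharpness their quotients h⁻¹ g coincide,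
-- and the row pair agreeing everywhere supplies the missing entry.
-- Backward: reading the rows through the enumeration x given by a fixed row
-- e turns them into a sharply k-transitive set of permutations containing
-- the identity; it is a group as soon as it is closed under composition.
-- For rows i ≠ e and j, let l be the row agreeing with i ∘ j on a fixed
-- k-tuple b. At a symbol y outside b the submatrices on rows (l, j) and
-- (i, e), with columns y,b and j y, j b respectively, agree everywhere
-- except possibly at y, so the rectangle condition gives l y = i (j y).
module Submission where

open import Defs
open import Level using (0ℓ)
open import Data.Nat using (ℕ; _≤_)
open import Data.Nat.Combinatorics using (_P_)
open import Data.Fin using (Fin; zero; suc; inject≤; punchIn)
open import Data.Fin.Properties
  using (_≟_; any?; inject≤-injective; punchIn-injective; punchInᵢ≢i)
open import Data.Vec.Functional using (_∷_; [])
open import Data.Product using (∃; ∃!; _,_; proj₁; proj₂)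
open import Data.Sum using (_⊎_; inj₁; inj₂)
open import Data.Empty using (⊥-elim)
open import Function using (_∘_)
open import Function.Definitions using (Bijective)
open import Function.Bundles using (_⇔_; mk⇔)
open import Relation.Nullary using (yes; no)
open import Relation.Binary.PropositionalEquality
open import Algebra.Bundles using (Group)

distinct-∷ : ∀ {m n} {y : Fin n} {u : Fin m → Fin n} →
             (∀ t → u t ≢ y) → Distinct u → Distinct (y ∷ u)
distinct-∷ y∉u du {zero}  {zero}  _ = refl
distinct-∷ y∉u du {zero}  {suc t} e = ⊥-elim (y∉u t (sym e))
distinct-∷ y∉u du {suc s} {zero}  e = ⊥-elim (y∉u s e)
distinct-∷ y∉u du {suc s} {suc t} e = cong suc (du e)

distinct-pair : ∀ {n} {y z : Fin n} → y ≢ z → Distinct (y ∷ z ∷ [])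
distinct-pair y≢z =
  distinct-∷ (λ { zero z≡y → y≢z (sym z≡y) ; (suc ()) _ }) (distinct-∷ (λ ()) λ { {()} })

other : Fin 2 → Fin 2
other zero       = suc zero
other (suc zero) = zero

other-≢ : ∀ p → other p ≢ p
other-≢ zero       ()
other-≢ (suc zero) ()

module GroupAction {c ℓ} (G : Group c ℓ) {n} {act : Group.Carrier G → Fin n → Fin n}
                   (isAction : IsAction G n act) where

  open Group G using (Carrier; _≈_; _∙_; _⁻¹; inverseˡ; inverseʳ)
  open IsAction isAction

  act-inverseˡ : ∀ g y → act (g ⁻¹) (act g y) ≡ y
  act-inverseˡ g y = begin
    act (g ⁻¹) (act g y) ≡⟨ act-∙ (g ⁻¹) g y ⟨
    act (g ⁻¹ ∙ g) y     ≡⟨ act-cong (inverseˡ g) y ⟩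
    act _ y              ≡⟨ act-ε y ⟩
    y                    ∎
    where open ≡-Reasoning

  act-inverseʳ : ∀ g y → act g (act (g ⁻¹) y) ≡ y
  act-inverseʳ g y = trans (sym (act-∙ g (g ⁻¹) y)) (trans (act-cong (inverseʳ g) y) (act-ε y))

  act-≡⇒act-quotient : ∀ {g h y z} → act g y ≡ act h z → act (h ⁻¹ ∙ g) y ≡ z
  act-≡⇒act-quotient {g} {h} {y} {z} eq = begin
    act (h ⁻¹ ∙ g) y     ≡⟨ act-∙ (h ⁻¹) g y ⟩
    act (h ⁻¹) (act g y) ≡⟨ cong (act (h ⁻¹)) eq ⟩
    act (h ⁻¹) (act h z) ≡⟨ act-inverseˡ h z ⟩
    z                    ∎
    where open ≡-Reasoning

  act-quotient⇒act-≡ : ∀ {g h y z} → act (h ⁻¹ ∙ g) y ≡ z → act g y ≡ act h z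
  act-quotient⇒act-≡ {g} {h} {y} {z} eq = begin
    act g y                      ≡⟨ act-inverseʳ h (act g y) ⟨
    act h (act (h ⁻¹) (act g y)) ≡⟨ cong (act h) (act-∙ (h ⁻¹) g y) ⟨
    act h (act (h ⁻¹ ∙ g) y)     ≡⟨ cong (act h) eq ⟩
    act h z                      ∎
    where open ≡-Reasoning

  module _ {k} (sharp : IsSharplyKTransitive G n k act) where

    sharp-unique : ∀ {u v : Fin k → Fin n} {g h} → Distinct u → Distinct v →
                   (∀ t → act g (u t) ≡ v t) → (∀ t → act h (u t) ≡ v t) → g ≈ h
    sharp-unique du dv gu≡v hu≡v with sharp _ _ du dv
    ... | _ , _ , unique = ≈-trans (≈-sym (unique gu≡v)) (unique hu≡v)
      where open Group G using () renaming (sym to ≈-sym; trans to ≈-trans)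

    orbit-rectangle : (x : Fin n → Fin n) → Distinct x → (R : Matrix n k) →
                      (∀ i → ∃ λ g → ∀ col → R i col ≡ act g (x col)) →
                      RectangleCondition n k R
    orbit-rectangle x x-inj R rows ρ ρ′ _ _ c c′ dc dc′ p q agree = begin
      R (ρ p) (c q)             ≡⟨ row (ρ p) (c q) ⟩
      act (g (ρ p)) (x (c q))   ≡⟨ act-quotient⇒act-≡ δp-moves-q ⟩
      act (g (ρ′ p)) (x (c′ q)) ≡⟨ row (ρ′ p) (c′ q) ⟨
      R (ρ′ p) (c′ q)           ∎
      where
      open ≡-Reasoning
      g : Fin (n P k) → Carrier
      g i = proj₁ (rows i)
      row : ∀ i col → R i col ≡ act (g i) (x col)
      row i = proj₂ (rows i)

      δ : Fin 2 → Carrier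
      δ p′ = g (ρ′ p′) ⁻¹ ∙ g (ρ p′)

      δ-moves : ∀ p′ q′ → p′ ≢ p ⊎ q′ ≢ q → act (δ p′) (x (c q′)) ≡ x (c′ q′)
      δ-moves p′ q′ off = act-≡⇒act-quotient
        (trans (sym (row (ρ p′) (c q′))) (trans (agree p′ q′ off) (row (ρ′ p′) (c′ q′))))

      δ-unique : δ p ≈ δ (other p)
      δ-unique = sharp-unique
        (λ e → punchIn-injective q _ _ (dc (x-inj e)))
        (λ e → punchIn-injective q _ _ (dc′ (x-inj e)))
        (λ t → δ-moves p (punchIn q t) (inj₂ (punchInᵢ≢i q t)))
        (λ t → δ-moves (other p) (punchIn q t) (inj₁ (other-≢ p)))

      δp-moves-q : act (δ p) (x (c q)) ≡ x (c′ q)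
      δp-moves-q = trans (act-cong δ-unique (x (c q))) (δ-moves (other p) q (inj₁ (other-≢ p)))

arises⇒rectangle : ∀ {n k} (R : Matrix n k) →
                   ArisesFromSharplyKTransitive n k R → RectangleCondition n k R
arises⇒rectangle R (G , _ , isAction , sharp , x , (x-inj , _) , rows , _) =
  GroupAction.orbit-rectangle G isAction sharp x x-inj R rows

module SharplyTransitiveFamily {N n k} (act : Fin N → Fin n → Fin n)
  (act-injective : ∀ i → Distinct (act i))
  (sharp : ∀ (u v : Fin k → Fin n) → Distinct u → Distinct v →
           ∃! _≡_ λ i → ∀ t → act i (u t) ≡ v t) where

  carry : (u v : Fin k → Fin n) → Distinct u → Distinct v → Fin N
  carry u v du dv = proj₁ (sharp u v du dv)

  carry-maps : ∀ {u v} (du : Distinct u) (dv : Distinct v) t → act (carry u v du dv) (u t) ≡ v t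
  carry-maps du dv = proj₁ (proj₂ (sharp _ _ du dv))

  determined-by : ∀ {u i j} → Distinct u → (∀ t → act i (u t) ≡ act j (u t)) → i ≡ j
  determined-by {u} {i} {j} du iu≡ju
    with sharp u (act j ∘ u) du (λ eq → du (act-injective j eq))
  ... | _ , _ , unique = trans (sym (unique iu≡ju)) (unique λ _ → refl)

  module ClosedUnderComposition
    (b : Fin k → Fin n) (db : Distinct b)
    (e : Fin N) (act-e : ∀ y → act e y ≡ y)
    (closed : ∀ i j → ∃ λ l → ∀ y → act l y ≡ act i (act j y)) where

    infixl 7 _∙_
    infix  8 _⁻¹

    _∙_ : Fin N → Fin N → Fin N
    i ∙ j = proj₁ (closed i j)

    act-∙ : ∀ i j y → act (i ∙ j) y ≡ act i (act j y)
    act-∙ i j = proj₂ (closed i j)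

    _⁻¹ : Fin N → Fin N
    i ⁻¹ = carry (act i ∘ b) b (λ eq → db (act-injective i eq)) db

    ⁻¹-undoes : ∀ i t → act (i ⁻¹) (act i (b t)) ≡ b t
    ⁻¹-undoes i = carry-maps _ db

    ≡-on-b : ∀ {i j} → (∀ t → act i (b t) ≡ act j (b t)) → i ≡ j
    ≡-on-b = determined-by db

    assoc : ∀ i j l → (i ∙ j) ∙ l ≡ i ∙ (j ∙ l)
    assoc i j l = ≡-on-b λ t → begin
      act ((i ∙ j) ∙ l) (b t)      ≡⟨ act-∙ (i ∙ j) l (b t) ⟩
      act (i ∙ j) (act l (b t))    ≡⟨ act-∙ i j _ ⟩
      act i (act j (act l (b t)))  ≡⟨ cong (act i) (act-∙ j l (b t)) ⟨
      act i (act (j ∙ l) (b t))    ≡⟨ act-∙ i (j ∙ l) (b t) ⟨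
      act (i ∙ (j ∙ l)) (b t)      ∎
      where open ≡-Reasoning

    identityˡ : ∀ i → e ∙ i ≡ i
    identityˡ i = ≡-on-b λ t → trans (act-∙ e i (b t)) (act-e _)

    identityʳ : ∀ i → i ∙ e ≡ i
    identityʳ i = ≡-on-b λ t → trans (act-∙ i e (b t)) (cong (act i) (act-e _))

    inverseˡ : ∀ i → i ⁻¹ ∙ i ≡ e
    inverseˡ i = ≡-on-b λ t →
      trans (act-∙ (i ⁻¹) i (b t)) (trans (⁻¹-undoes i t) (sym (act-e _)))

    inverseʳ : ∀ i → i ∙ i ⁻¹ ≡ e
    inverseʳ i = determined-by (λ eq → db (act-injective i eq)) λ t →
      trans (act-∙ i (i ⁻¹) _) (trans (cong (act i) (⁻¹-undoes i t)) (sym (act-e _)))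

    group : Group 0ℓ 0ℓ
    group = record
      { Carrier = Fin N ; _≈_ = _≡_ ; _∙_ = _∙_ ; ε = e ; _⁻¹ = _⁻¹
      ; isGroup = record
        { isMonoid = record
          { isSemigroup = record
            { isMagma = record { isEquivalence = isEquivalence ; ∙-cong = cong₂ _∙_ }
            ; assoc = assoc }
          ; identity = identityˡ , identityʳ }
        ; inverse = inverseˡ , inverseʳ
        ; ⁻¹-cong = cong _⁻¹ } }

    isAction : IsAction group n act
    isAction = record { act-cong = λ { refl y → refl } ; act-ε = act-e ; act-∙ = act-∙ }

module RowGroup {n k} (R : Matrix n k) (C : IsCarthaginian n k R)
                (RC : RectangleCondition n k R) (b : Fin k → Fin n) (db : Distinct b) where

  rows-bijective : ∀ i → Bijective _≡_ _≡_ (R i)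
  rows-bijective = proj₁ C

  -- Any row would serve as e; this one just witnesses that there is a row.
  e : Fin (n P k)
  e = proj₁ (proj₂ C b db b db)

  x : Fin n → Fin n
  x = R e

  x-injective : Distinct x
  x-injective = proj₁ (rows-bijective e)

  x⁻¹ : Fin n → Fin n
  x⁻¹ y = proj₁ (proj₂ (rows-bijective e) y)

  x-x⁻¹ : ∀ y → x (x⁻¹ y) ≡ y
  x-x⁻¹ y = proj₂ (proj₂ (rows-bijective e) y) refl

  x⁻¹-x : ∀ col → x⁻¹ (x col) ≡ col
  x⁻¹-x col = x-injective (x-x⁻¹ (x col))

  x⁻¹-injective : Distinct x⁻¹
  x⁻¹-injective {y} {z} eq = trans (sym (x-x⁻¹ y)) (trans (cong x eq) (x-x⁻¹ z))

  act : Fin (n P k) → Fin n → Fin n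
  act i y = R i (x⁻¹ y)

  act-injective : ∀ i → Distinct (act i)
  act-injective i eq = x⁻¹-injective (proj₁ (rows-bijective i) eq)

  act-e : ∀ y → act e y ≡ y
  act-e = x-x⁻¹

  sharp : ∀ (u v : Fin k → Fin n) → Distinct u → Distinct v →
          ∃! _≡_ λ i → ∀ t → act i (u t) ≡ v t
  sharp u v du dv = proj₂ C (x⁻¹ ∘ u) (λ eq → du (x⁻¹-injective eq)) v dv

  open SharplyTransitiveFamily act act-injective sharp

  compose : Fin (n P k) → Fin (n P k) → Fin (n P k)
  compose i j = carry b (act i ∘ act j ∘ b) db (λ eq → db (act-injective j (act-injective i eq)))

  compose-on-b : ∀ i j t → act (compose i j) (b t) ≡ act i (act j (b t))
  compose-on-b i j = carry-maps db _

  compose-e : ∀ j → compose e j ≡ j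
  compose-e j = determined-by db λ t → trans (compose-on-b e j t) (act-e _)

  compose-off-b : ∀ {i j y} → i ≢ e → (∀ t → b t ≢ y) →
                  act (compose i j) y ≡ act i (act j y)
  compose-off-b {i} {j} {y} i≢e y∉b =
    RC (l ∷ j ∷ []) (i ∷ e ∷ []) (distinct-pair l≢j) (distinct-pair i≢e)
       c c′ dc dc′ zero zero agree
    where
    l : Fin (n P k)
    l = compose i j
    a : Fin (ℕ.suc k) → Fin n
    a = y ∷ b
    da : Distinct a
    da = distinct-∷ y∉b db
    c c′ : Fin (ℕ.suc k) → Fin n
    c  = x⁻¹ ∘ a
    c′ = x⁻¹ ∘ act j ∘ a
    dc : Distinct c
    dc eq = da (x⁻¹-injective eq)
    dc′ : Distinct c′
    dc′ eq = da (act-injective j (x⁻¹-injective eq))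

    l≢j : l ≢ j
    l≢j l≡j = i≢e (determined-by (λ eq → db (act-injective j eq)) λ t →
      trans (sym (compose-on-b i j t))
            (trans (cong (λ r → act r (b t)) l≡j) (sym (act-e _))))

    agree : ∀ p′ q′ → p′ ≢ zero ⊎ q′ ≢ zero →
            R ((l ∷ j ∷ []) p′) (c q′) ≡ R ((i ∷ e ∷ []) p′) (c′ q′)
    agree zero       zero    (inj₁ 0≢0) = ⊥-elim (0≢0 refl)
    agree zero       zero    (inj₂ 0≢0) = ⊥-elim (0≢0 refl)
    agree zero       (suc t) _          = compose-on-b i j t
    agree (suc zero) q′      _          = sym (act-e (act j (a q′)))

  act-compose : ∀ i j y → act (compose i j) y ≡ act i (act j y)
  act-compose i j y with i ≟ e | any? (λ t → b t ≟ y)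
  ... | yes refl | _              = trans (cong (λ r → act r y) (compose-e j)) (sym (act-e _))
  ... | no _     | yes (t , refl) = compose-on-b i j t
  ... | no i≢e   | no y∉b         = compose-off-b i≢e (λ t bt≡y → y∉b (t , bt≡y))

  open ClosedUnderComposition b db e act-e (λ i j → compose i j , act-compose i j)

  in-orbit : ∀ i col → R i col ≡ act i (x col)
  in-orbit i col = cong (R i) (sym (x⁻¹-x col))

  arises : ArisesFromSharplyKTransitive n k R
  arises = group , act , isAction , sharp , x , rows-bijective e
         , (λ i → i , in-orbit i)
         , λ g → g , in-orbit g , λ {i} i-in-orbit → determined-by db λ t →
             sym (trans (i-in-orbit (x⁻¹ (b t))) (cong (act g) (x-x⁻¹ (b t))))

theorem3p3 : (n k : ℕ) → 1 ≤ k → k ≤ n → (R : Matrix n k) → IsCarthaginian n k R →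
    ArisesFromSharplyKTransitive n k R ⇔ RectangleCondition n k R
theorem3p3 n k _ k≤n R C = mk⇔ (arises⇒rectangle R) (λ RC → RowGroup.arises R C RC b db)
  where
  b : Fin k → Fin n
  b t = inject≤ t k≤n
  db : Distinct b
  db {s} {t} = inject≤-injective k≤n k≤n s t
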